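{- Let $N\ge1$ and let $q,\gamma,s_0,\xi_0$ be generic complex parameters with $s_0\xi_0\gamma\ne0$, and set $u_0=(s_0\xi_0\gamma)^{ -1}$. Define \[\mathsf{z}(u,v)=\frac{(1-\gamma)(q-\gamma s_0^2)(1-uv)+(1-q)(1-\gamma\xi_0s_0u)(1-\gamma\xi_0^{ -1}s_0v)}{(1-uv)(1-quv)}.\] Then, with $u_i=u_0q^{i-1}$ for $i=1,\ldots,N$ and generic $v_1,\ldots,v_N$, \[\frac{\prod_{i,j=1}^N(1-u_iv_j)(1-qu_iv_j)}{\prod_{1\le i<j\le N}(u_i-u_j)(v_i-v_j)}\det\big[\mathsf{z}(u_i,v_j)\big]_{i,j=1}^N =q^{N^2}\prod_{i,j=1}^N\Big(1-v_i\frac{q^{j-1}}{s_0\xi_0\gamma}\Big)\prod_{j=1}^N(1-\gamma q^{ -j+1})(1-s_0^2\gamma q^{ -j}).\] -}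

module Defs where

open import Level using (Level; _⊔_) renaming (suc to lsuc)
open import Data.Nat using (ℕ; zero; suc)
open import Data.Fin using (Fin; zero; suc; punchIn; toℕ; _<?_)
open import Data.Bool using (if_then_else_)
open import Relation.Nullary using (¬_; does)
open import Algebra.Bundles using (CommutativeRing)

record Field (c ℓ : Level) : Set (lsuc (c ⊔ ℓ)) where
  field
    commutativeRing : CommutativeRing c ℓ
  open CommutativeRing commutativeRing public
  field
    _⁻¹      : Carrier → Carrier
    ⁻¹-cong  : ∀ {x y} → x ≈ y → x ⁻¹ ≈ y ⁻¹
    0#≉1#    : ¬ (0# ≈ 1#)
    ⁻¹-inverse : ∀ x → ¬ (x ≈ 0#) → x * x ⁻¹ ≈ 1#

module FieldOps {c ℓ : Level} (F : Field c ℓ) where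
  open Field F using (Carrier; _+_; _*_; -_; _-_; 0#; 1#; _⁻¹)

  pow : Carrier → ℕ → Carrier
  pow x zero    = 1#
  pow x (suc n) = x * pow x n

  sumFin : (n : ℕ) → (Fin n → Carrier) → Carrier
  sumFin zero    f = 0#
  sumFin (suc n) f = f zero + sumFin n (λ i → f (suc i))

  prodFin : (n : ℕ) → (Fin n → Carrier) → Carrier
  prodFin zero    f = 1#
  prodFin (suc n) f = f zero * prodFin n (λ i → f (suc i))

  sgn : {n : ℕ} → Fin n → Carrier
  sgn zero    = 1#
  sgn (suc j) = - sgn j

  det : (n : ℕ) → (Fin n → Fin n → Carrier) → Carrier
  det zero    M = 1#
  det (suc n) M = sumFin (suc n) (λ j →
    sgn j * (M zero j * det n (λ i k → M (suc i) (punchIn j k))))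

  prodLt : (n : ℕ) → (Fin n → Fin n → Carrier) → Carrier
  prodLt n f = prodFin n (λ i → prodFin n (λ j →
    if does (i <? j) then f i j else 1#))

  zfun : (q γ s₀ ξ₀ u v : Carrier) → Carrier
  zfun q γ s₀ ξ₀ u v =
    ( ((1# - γ) * (q - γ * (s₀ * s₀))) * (1# - u * v)
    + ((1# - q) * (1# - ((γ * ξ₀) * s₀) * u)) * (1# - ((γ * ξ₀ ⁻¹) * s₀) * v) )
    * ((1# - u * v) * (1# - (q * u) * v)) ⁻¹

{-# OPTIONS --safe #-}
-- Partial fractions in v give z(uᵢ, v) = Aᵢ/(1 − uᵢv) + Bᵢ/(1 − q uᵢv) with A₀ = 0. Since q uᵢ = uᵢ₊₁,
-- the matrix [z(uᵢ, vⱼ)] is L·C with L lower bidiagonal (diagonal B, subdiagonal A) and C the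
-- Cauchy-type matrix [1/(1 − xᵢvⱼ)], xᵢ = q uᵢ. So its determinant is ∏ Bᵢ times the Cauchy determinant
-- ∏_{i<j} (xᵢ − xⱼ)(vᵢ − vⱼ) / ∏_{i,j} (1 − xᵢvⱼ). This is proved directly by induction on N, without
-- multiplicativity of det: subtracting multiples of the first column clears the first row and leaves
-- a matrix of the same shape in N − 1 variables. Finally Bᵢ = q^{i+1} (1 − γq^{−i}) (1 − s₀²γq^{−i−1}),
-- and the Vandermonde product of the xᵢ = u₀q^{i+1} is q^{N(N−1)/2} times that of the uᵢ; with
-- ∏ q^{i+1} = q^{N(N+1)/2} this gives the factor q^{N²}.
module Submission where

open import Defs
open import Level using (Level)
open import Data.Nat using (ℕ; _≤_)
import Data.Nat
open import Data.Fin using (Fin; toℕ; _<_)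
open import Relation.Nullary using (¬_)

open import Algebra.Bundles using (CommutativeRing; RawRing)
open import Algebra.Solver.Ring.AlmostCommutativeRing
  using (fromCommutativeRing; _-Raw-AlmostCommutative⟶_; Induced-equivalence)
open import Data.Bool.Base using (if_then_else_)
open import Data.Fin.Base using (zero; suc; fromℕ<; punchIn; punchOut; inject₁)
open import Data.Fin.Properties
  using ( _≟_; _<?_; suc-injective; toℕ<n; toℕ-injective; toℕ-fromℕ<; toℕ-inject₁
        ; punchInᵢ≢i; punchIn-injective; punchIn-punchOut)
open import Data.Integer.Base as ℤ using (ℤ; +_; -[1+_]; _⊖_; _◃_; sign; ∣_∣)
import Data.Integer.Properties as ℤ
open import Data.Maybe.Base using (just; nothing)
open import Data.Nat.Base as ℕ using (zero; suc)
import Data.Nat.Properties as ℕ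
import Data.Nat.Solver
open import Data.Product.Base using (∃; _×_; _,_)
open import Data.Sign.Base as Sign using (Sign)
open import Data.Sum.Base using (_⊎_; inj₁; inj₂)
open import Data.Vec.Functional using (updateAt)
open import Data.Vec.Functional.Properties using (updateAt-updates; updateAt-minimal)
open import Relation.Binary.Definitions using (WeaklyDecidable)
open import Relation.Binary.PropositionalEquality as ≡ using (_≡_; _≢_)
open import Relation.Nullary using (Dec; does; yes; no)
open import Relation.Nullary.Negation using (contradiction)

-- The library's ring solvers, instantiated at an abstract ring, take their coefficients in that ring,
-- where 1 − 1 ≈ 0 is not decidable; here Algebra.Solver.Ring runs with integer coefficients via ℤ → R.
module ℤ-CoefficientRingSolver {c ℓ : Level} (R : CommutativeRing c ℓ) where
  open CommutativeRing R
  open import Algebra.Properties.Ring ring using (-‿involutive; -‿distribˡ-*; -‿+-comm; -0#≈0#)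
  open import Algebra.Properties.Semiring.Mult.TCOptimised semiring using (1+×; ×-homo-+; ×1-homo-*) renaming (_×_ to _×ᵣ_)
  open import Algebra.Properties.CommutativeSemigroup +-commutativeSemigroup using () renaming (interchange to +-interchange)
  open import Algebra.Properties.CommutativeSemigroup *-commutativeSemigroup using () renaming (interchange to *-interchange)
  open import Relation.Binary.Reasoning.Setoid setoid

  fromSign : Sign → Carrier
  fromSign Sign.+ = 1#
  fromSign Sign.- = - 1#

  fromℤ : ℤ → Carrier
  fromℤ (+ n)    = n ×ᵣ 1#
  fromℤ -[1+ n ] = - (suc n ×ᵣ 1#)

  fromSign-homo-* : ∀ s t → fromSign (s Sign.* t) ≈ fromSign s * fromSign t
  fromSign-homo-* Sign.+ t      = sym (*-identityˡ _)
  fromSign-homo-* Sign.- Sign.+ = sym (*-identityʳ _)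
  fromSign-homo-* Sign.- Sign.- = begin
    1#              ≈⟨ -‿involutive 1# ⟨
    - (- 1#)        ≈⟨ -‿cong (*-identityˡ (- 1#)) ⟨
    - (1# * - 1#)   ≈⟨ -‿distribˡ-* 1# (- 1#) ⟩
    - 1# * - 1#     ∎

  fromℤ-homo-◃ : ∀ s n → fromℤ (s ◃ n) ≈ fromSign s * (n ×ᵣ 1#)
  fromℤ-homo-◃ s      zero    = sym (zeroʳ _)
  fromℤ-homo-◃ Sign.+ (suc n) = sym (*-identityˡ _)
  fromℤ-homo-◃ Sign.- (suc n) = trans (-‿cong (sym (*-identityˡ _))) (-‿distribˡ-* _ _)

  fromℤ-homo-‿ : ∀ i → fromℤ (ℤ.- i) ≈ - fromℤ i
  fromℤ-homo-‿ (+ zero)  = sym -0#≈0#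
  fromℤ-homo-‿ (+ suc n) = refl
  fromℤ-homo-‿ -[1+ n ]  = sym (-‿involutive _)

  fromℤ-homo-⊖ : ∀ m n → fromℤ (m ⊖ n) ≈ m ×ᵣ 1# - n ×ᵣ 1#
  fromℤ-homo-⊖ zero    zero    = sym (-‿inverseʳ 0#)
  fromℤ-homo-⊖ zero    (suc n) = sym (+-identityˡ _)
  fromℤ-homo-⊖ (suc m) zero    = sym (trans (+-congˡ -0#≈0#) (+-identityʳ _))
  fromℤ-homo-⊖ (suc m) (suc n) = begin
    fromℤ (suc m ⊖ suc n)          ≡⟨ ≡.cong fromℤ (ℤ.[1+m]⊖[1+n]≡m⊖n m n) ⟩
    fromℤ (m ⊖ n)                  ≈⟨ fromℤ-homo-⊖ m n ⟩
    a - b                          ≈⟨ +-identityˡ _ ⟨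
    0# + (a - b)                   ≈⟨ +-congʳ (-‿inverseʳ 1#) ⟨
    (1# - 1#) + (a - b)            ≈⟨ +-interchange 1# (- 1#) a (- b) ⟩
    (1# + a) + (- 1# - b)          ≈⟨ +-congˡ (-‿+-comm 1# b) ⟩
    (1# + a) - (1# + b)            ≈⟨ +-cong (1+× m 1#) (-‿cong (1+× n 1#)) ⟨
    suc m ×ᵣ 1# - suc n ×ᵣ 1#        ∎
    where a = m ×ᵣ 1#; b = n ×ᵣ 1#

  fromℤ-homo-+ : ∀ i j → fromℤ (i ℤ.+ j) ≈ fromℤ i + fromℤ j
  fromℤ-homo-+ (+ m)    (+ n)    = ×-homo-+ 1# m n
  fromℤ-homo-+ (+ m)    -[1+ n ] = fromℤ-homo-⊖ m (suc n)
  fromℤ-homo-+ -[1+ m ] (+ n)    = trans (fromℤ-homo-⊖ n (suc m)) (+-comm _ _)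
  fromℤ-homo-+ -[1+ m ] -[1+ n ] = begin
    - (suc (suc m ℕ.+ n) ×ᵣ 1#)           ≡⟨ ≡.cong (λ k → - (k ×ᵣ 1#)) (≡.sym (ℕ.+-suc (suc m) n)) ⟩
    - ((suc m ℕ.+ suc n) ×ᵣ 1#)           ≈⟨ -‿cong (×-homo-+ 1# (suc m) (suc n)) ⟩
    - (suc m ×ᵣ 1# + suc n ×ᵣ 1#)          ≈⟨ -‿+-comm _ _ ⟨
    - (suc m ×ᵣ 1#) + - (suc n ×ᵣ 1#)      ∎

  fromℤ-homo-* : ∀ i j → fromℤ (i ℤ.* j) ≈ fromℤ i * fromℤ j
  fromℤ-homo-* i j = begin
    fromℤ (sign i Sign.* sign j ◃ ∣ i ∣ ℕ.* ∣ j ∣)   ≈⟨ fromℤ-homo-◃ (sign i Sign.* sign j) (∣ i ∣ ℕ.* ∣ j ∣) ⟩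
    fromSign (sign i Sign.* sign j) * ((∣ i ∣ ℕ.* ∣ j ∣) ×ᵣ 1#)
      ≈⟨ *-cong (fromSign-homo-* (sign i) (sign j)) (×1-homo-* ∣ i ∣ ∣ j ∣) ⟩
    (s * t) * (a * b)                                ≈⟨ *-interchange s t a b ⟩
    (s * a) * (t * b)
      ≈⟨ *-cong (fromℤ-homo-◃ (sign i) ∣ i ∣) (fromℤ-homo-◃ (sign j) ∣ j ∣) ⟨
    fromℤ (sign i ◃ ∣ i ∣) * fromℤ (sign j ◃ ∣ j ∣)
      ≡⟨ ≡.cong₂ (λ x y → fromℤ x * fromℤ y) (ℤ.◃-inverse i) (ℤ.◃-inverse j) ⟩
    fromℤ i * fromℤ j                                ∎
    where
    s = fromSign (sign i); t = fromSign (sign j); a = ∣ i ∣ ×ᵣ 1#; b = ∣ j ∣ ×ᵣ 1#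

  ℤ-rawRing : RawRing _ _
  ℤ-rawRing = record
    { Carrier = ℤ ; _≈_ = _≡_ ; _+_ = ℤ._+_ ; _*_ = ℤ._*_ ; -_ = ℤ.-_ ; 0# = + 0 ; 1# = + 1 }

  fromℤ-morphism : ℤ-rawRing -Raw-AlmostCommutative⟶ fromCommutativeRing R
  fromℤ-morphism = record
    { ⟦_⟧ = fromℤ ; +-homo = fromℤ-homo-+ ; *-homo = fromℤ-homo-* ; -‿homo = fromℤ-homo-‿ ; 0-homo = refl ; 1-homo = refl }

  fromℤ-≟ : WeaklyDecidable (Induced-equivalence fromℤ-morphism)
  fromℤ-≟ i j with i ℤ.≟ j
  ... | yes ≡.refl = just refl
  ... | no  _      = nothing

  open import Algebra.Solver.Ring ℤ-rawRing (fromCommutativeRing R) fromℤ-morphism fromℤ-≟ public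
    using (Polynomial; solve; _:=_; _:+_; _:*_; :-_; _:-_; con)

  0ᴾ 1ᴾ : ∀ {n} → Polynomial n
  0ᴾ = con (+ 0)
  1ᴾ = con (+ 1)


module FieldArithmetic {c ℓ : Level} (F : Field c ℓ) where
  open Field F hiding (zero)
  open FieldOps F
  open import Algebra.Properties.CommutativeSemigroup *-commutativeSemigroup using () renaming (interchange to *-interchange)
  open import Relation.Binary.Reasoning.Setoid setoid

  1#≉0# : ¬ (1# ≈ 0#)
  1#≉0# 1≈0 = 0#≉1# (sym 1≈0)

  ⁻¹-inverseˡ : ∀ x → ¬ (x ≈ 0#) → x ⁻¹ * x ≈ 1#
  ⁻¹-inverseˡ x x≉0 = trans (*-comm _ _) (⁻¹-inverse x x≉0)

  *-≉0 : ∀ {x y} → ¬ (x ≈ 0#) → ¬ (y ≈ 0#) → ¬ (x * y ≈ 0#)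
  *-≉0 {x} {y} x≉0 y≉0 xy≈0 = y≉0 (begin
    y                ≈⟨ *-identityˡ y ⟨
    1# * y           ≈⟨ *-congʳ (⁻¹-inverseˡ x x≉0) ⟨
    (x ⁻¹ * x) * y   ≈⟨ *-assoc _ _ _ ⟩
    x ⁻¹ * (x * y)   ≈⟨ *-congˡ xy≈0 ⟩
    x ⁻¹ * 0#        ≈⟨ zeroʳ _ ⟩
    0#               ∎)

  ⁻¹-unique : ∀ {x y} → ¬ (x ≈ 0#) → x * y ≈ 1# → x ⁻¹ ≈ y
  ⁻¹-unique {x} {y} x≉0 xy≈1 = begin
    x ⁻¹              ≈⟨ *-identityʳ _ ⟨
    x ⁻¹ * 1#         ≈⟨ *-congˡ xy≈1 ⟨
    x ⁻¹ * (x * y)    ≈⟨ *-assoc _ _ _ ⟨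
    (x ⁻¹ * x) * y    ≈⟨ *-congʳ (⁻¹-inverseˡ x x≉0) ⟩
    1# * y            ≈⟨ *-identityˡ y ⟩
    y                 ∎

  ⁻¹-distrib-* : ∀ {x y} → ¬ (x ≈ 0#) → ¬ (y ≈ 0#) → (x * y) ⁻¹ ≈ x ⁻¹ * y ⁻¹
  ⁻¹-distrib-* {x} {y} x≉0 y≉0 = ⁻¹-unique (*-≉0 x≉0 y≉0) (begin
    (x * y) * (x ⁻¹ * y ⁻¹)      ≈⟨ *-interchange x y (x ⁻¹) (y ⁻¹) ⟩
    (x * x ⁻¹) * (y * y ⁻¹)      ≈⟨ *-cong (⁻¹-inverse x x≉0) (⁻¹-inverse y y≉0) ⟩
    1# * 1#                      ≈⟨ *-identityˡ 1# ⟩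
    1#                           ∎)

  x≈1⇒1-x≈0 : ∀ {x} → x ≈ 1# → 1# - x ≈ 0#
  x≈1⇒1-x≈0 x≈1 = trans (+-congˡ (-‿cong x≈1)) (-‿inverseʳ 1#)

  pow-+ : ∀ x m n → pow x (m ℕ.+ n) ≈ pow x m * pow x n
  pow-+ x zero    n = sym (*-identityˡ _)
  pow-+ x (suc m) n = trans (*-congˡ (pow-+ x m n)) (sym (*-assoc _ _ _))

  pow-*-pow⁻¹ : ∀ x n → ¬ (x ≈ 0#) → pow x n * pow (x ⁻¹) n ≈ 1#
  pow-*-pow⁻¹ x zero    _   = *-identityˡ 1#
  pow-*-pow⁻¹ x (suc n) x≉0 = begin
    (x * pow x n) * (x ⁻¹ * pow (x ⁻¹) n)
      ≈⟨ *-interchange x (pow x n) (x ⁻¹) (pow (x ⁻¹) n) ⟩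
    (x * x ⁻¹) * (pow x n * pow (x ⁻¹) n)   ≈⟨ *-cong (⁻¹-inverse x x≉0) (pow-*-pow⁻¹ x n x≉0) ⟩
    1# * 1#                                 ≈⟨ *-identityˡ 1# ⟩
    1#                                      ∎

module FiniteSumsAndProducts {c ℓ : Level} (F : Field c ℓ) where
  open Field F hiding (zero)
  open FieldOps F
  open FieldArithmetic F
  open ℤ-CoefficientRingSolver commutativeRing
  open import Algebra.Properties.CommutativeSemigroup +-commutativeSemigroup using () renaming (interchange to +-interchange)
  open import Algebra.Properties.CommutativeSemigroup *-commutativeSemigroup using () renaming (interchange to *-interchange)
  open import Relation.Binary.Reasoning.Setoid setoid

  sumFin-cong : ∀ n {f g : Fin n → Carrier} → (∀ i → f i ≈ g i) → sumFin n f ≈ sumFin n g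
  sumFin-cong zero    f≈g = refl
  sumFin-cong (suc n) f≈g = +-cong (f≈g zero) (sumFin-cong n (λ i → f≈g (suc i)))

  sumFin-zero : ∀ n {f : Fin n → Carrier} → (∀ i → f i ≈ 0#) → sumFin n f ≈ 0#
  sumFin-zero zero    f≈0 = refl
  sumFin-zero (suc n) f≈0 = trans (+-cong (f≈0 zero) (sumFin-zero n (λ i → f≈0 (suc i)))) (+-identityˡ 0#)

  sumFin-distrib-+ : ∀ n (f g : Fin n → Carrier) → sumFin n (λ i → f i + g i) ≈ sumFin n f + sumFin n g
  sumFin-distrib-+ zero    f g = sym (+-identityˡ 0#)
  sumFin-distrib-+ (suc n) f g = trans (+-congˡ (sumFin-distrib-+ n _ _))
    (+-interchange _ _ _ _)

  *-distribˡ-sumFin : ∀ n x (f : Fin n → Carrier) → sumFin n (λ i → x * f i) ≈ x * sumFin n f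
  *-distribˡ-sumFin zero    x f = sym (zeroʳ x)
  *-distribˡ-sumFin (suc n) x f = trans (+-congˡ (*-distribˡ-sumFin n x _)) (sym (distribˡ _ _ _))

  sumFin-cancellingPair : ∀ n (f : Fin (suc n) → Carrier) (k : Fin n) →
    (∀ j → j ≢ inject₁ k → j ≢ suc k → f j ≈ 0#) → f (inject₁ k) + f (suc k) ≈ 0# →
    sumFin (suc n) f ≈ 0#
  sumFin-cancellingPair (suc n) f zero others≈0 pair≈0 = begin
    f zero + (f (suc zero) + sumFin n (λ i → f (suc (suc i))))
      ≈⟨ +-congˡ (+-congˡ (sumFin-zero n (λ i → others≈0 (suc (suc i)) (λ ()) (λ ())))) ⟩
    f zero + (f (suc zero) + 0#)  ≈⟨ +-congˡ (+-identityʳ _) ⟩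
    f zero + f (suc zero)         ≈⟨ pair≈0 ⟩
    0#                            ∎
  sumFin-cancellingPair (suc n) f (suc k) others≈0 pair≈0 = begin
    f zero + sumFin (suc n) (λ i → f (suc i))
      ≈⟨ +-cong (others≈0 zero (λ ()) (λ ())) (sumFin-cancellingPair n (λ i → f (suc i)) k
           (λ j j≢k j≢k+1 → others≈0 (suc j) (λ eq → j≢k (suc-injective eq)) (λ eq → j≢k+1 (suc-injective eq))) pair≈0) ⟩
    0# + 0#   ≈⟨ +-identityˡ 0# ⟩
    0#        ∎

  prodFin-cong : ∀ n {f g : Fin n → Carrier} → (∀ i → f i ≈ g i) → prodFin n f ≈ prodFin n g
  prodFin-cong zero    f≈g = refl
  prodFin-cong (suc n) f≈g = *-cong (f≈g zero) (prodFin-cong n (λ i → f≈g (suc i)))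

  prodFin-distrib-* : ∀ n (f g : Fin n → Carrier) → prodFin n (λ i → f i * g i) ≈ prodFin n f * prodFin n g
  prodFin-distrib-* zero    f g = sym (*-identityˡ 1#)
  prodFin-distrib-* (suc n) f g = trans (*-congˡ (prodFin-distrib-* n _ _))
    (*-interchange _ _ _ _)

  prodFin-remove : ∀ n (f : Fin (suc n) → Carrier) (j : Fin (suc n)) →
    prodFin (suc n) f ≈ f j * prodFin n (λ l → f (punchIn j l))
  prodFin-remove n       f zero    = refl
  prodFin-remove (suc n) f (suc j) = trans (*-congˡ (prodFin-remove n (λ i → f (suc i)) j))
    (solve 3 (λ a b c → a :* (b :* c) := b :* (a :* c)) refl _ _ _)

  prodFin-const : ∀ n x → prodFin n (λ _ → x) ≈ pow x n
  prodFin-const zero    x = refl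
  prodFin-const (suc n) x = *-congˡ (prodFin-const n x)

  prodFin-1 : ∀ n → prodFin n (λ _ → 1#) ≈ 1#
  prodFin-1 zero    = refl
  prodFin-1 (suc n) = trans (*-identityˡ _) (prodFin-1 n)

  prodFin-comm : ∀ m n (f : Fin m → Fin n → Carrier) →
    prodFin m (λ i → prodFin n (λ j → f i j)) ≈ prodFin n (λ j → prodFin m (λ i → f i j))
  prodFin-comm zero    n f = sym (prodFin-1 n)
  prodFin-comm (suc m) n f = trans (*-congˡ (prodFin-comm m n (λ i → f (suc i))))
    (sym (prodFin-distrib-* n (f zero) (λ j → prodFin m (λ i → f (suc i) j))))

  prodFin-≉0 : ∀ n {f : Fin n → Carrier} → (∀ i → ¬ (f i ≈ 0#)) → ¬ (prodFin n f ≈ 0#)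
  prodFin-≉0 zero    f≉0 = 1#≉0#
  prodFin-≉0 (suc n) f≉0 = *-≉0 (f≉0 zero) (prodFin-≉0 n (λ i → f≉0 (suc i)))

  prodFin-neg² : ∀ n (f g : Fin n → Carrier) →
    prodFin n f * prodFin n g ≈ prodFin n (λ i → - f i) * prodFin n (λ i → - g i)
  prodFin-neg² n f g = begin
    prodFin n f * prodFin n g                        ≈⟨ prodFin-distrib-* n f g ⟨
    prodFin n (λ i → f i * g i)
      ≈⟨ prodFin-cong n (λ i → solve 2 (λ a b → a :* b := (:- a) :* (:- b)) refl (f i) (g i)) ⟩
    prodFin n (λ i → (- f i) * (- g i))              ≈⟨ prodFin-distrib-* n _ _ ⟩
    prodFin n (λ i → - f i) * prodFin n (λ i → - g i) ∎

  prodFin-scale : ∀ n x (f : Fin n → Carrier) → prodFin n (λ i → x * f i) ≈ pow x n * prodFin n f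
  prodFin-scale n x f = trans (prodFin-distrib-* n (λ _ → x) f) (*-congʳ (prodFin-const n x))

triangular : ℕ → ℕ
triangular zero    = 0
triangular (suc n) = n ℕ.+ triangular n

module PairProducts {c ℓ : Level} (F : Field c ℓ) where
  open Field F hiding (zero)
  open FieldOps F
  open FieldArithmetic F
  open FiniteSumsAndProducts F
  open import Algebra.Properties.Ring ring using (x[y-z]≈xy-xz)
  open import Algebra.Properties.CommutativeSemigroup *-commutativeSemigroup using () renaming (interchange to *-interchange)
  open import Relation.Binary.Reasoning.Setoid setoid

  prodLt-suc : ∀ n (f : Fin (suc n) → Fin (suc n) → Carrier) →
    prodLt (suc n) f ≈ prodFin n (λ j → f zero (suc j)) * prodLt n (λ i j → f (suc i) (suc j))
  prodLt-suc n f = *-cong (*-identityˡ _) (prodFin-cong n (λ i → *-identityˡ _))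

  prodLt-distrib-* : ∀ n (f g : Fin n → Fin n → Carrier) →
    prodLt n (λ i j → f i j * g i j) ≈ prodLt n f * prodLt n g
  prodLt-distrib-* zero    f g = sym (*-identityˡ 1#)
  prodLt-distrib-* (suc n) f g = begin
    prodLt (suc n) (λ i j → f i j * g i j)
      ≈⟨ prodLt-suc n (λ i j → f i j * g i j) ⟩
    prodFin n (λ j → f zero (suc j) * g zero (suc j)) * prodLt n (λ i j → f (suc i) (suc j) * g (suc i) (suc j))
      ≈⟨ *-cong (prodFin-distrib-* n _ _) (prodLt-distrib-* n _ _) ⟩
    (prodFin n (λ j → f zero (suc j)) * prodFin n (λ j → g zero (suc j)))
      * (prodLt n (λ i j → f (suc i) (suc j)) * prodLt n (λ i j → g (suc i) (suc j)))
      ≈⟨ *-interchange _ _ _ _ ⟩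
    (prodFin n (λ j → f zero (suc j)) * prodLt n (λ i j → f (suc i) (suc j)))
      * (prodFin n (λ j → g zero (suc j)) * prodLt n (λ i j → g (suc i) (suc j)))
      ≈⟨ *-cong (prodLt-suc n f) (prodLt-suc n g) ⟨
    prodLt (suc n) f * prodLt (suc n) g ∎

  prodLt-≉0 : ∀ n {f : Fin n → Fin n → Carrier} → (∀ i j → i < j → ¬ (f i j ≈ 0#)) → ¬ (prodLt n f ≈ 0#)
  prodLt-≉0 n {f} f≉0 = prodFin-≉0 n (λ i → prodFin-≉0 n (λ j → entry≉0 i j))
    where
    entry≉0 : ∀ i j → ¬ ((if does (i <? j) then f i j else 1#) ≈ 0#)
    entry≉0 i j = decide (i <? j)
      where
      decide : (i<?j : Dec (i < j)) → ¬ ((if does i<?j then f i j else 1#) ≈ 0#)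
      decide (yes i<j) = f≉0 i j i<j
      decide (no  _)   = 1#≉0#

  prodFin-pow : ∀ n x → prodFin n (λ j → pow x (toℕ j)) ≈ pow x (triangular n)
  prodFin-pow zero    x = refl
  prodFin-pow (suc n) x = begin
    1# * prodFin n (λ j → x * pow x (toℕ j))    ≈⟨ *-identityˡ _ ⟩
    prodFin n (λ j → x * pow x (toℕ j))         ≈⟨ prodFin-scale n x _ ⟩
    pow x n * prodFin n (λ j → pow x (toℕ j))   ≈⟨ *-congˡ (prodFin-pow n x) ⟩
    pow x n * pow x (triangular n)              ≈⟨ pow-+ x n (triangular n) ⟨
    pow x (n ℕ.+ triangular n)                  ∎

  vandermonde : ∀ n → (Fin n → Carrier) → Carrier
  vandermonde n a = prodLt n (λ i j → a i - a j)

  vandermonde-scale : ∀ n x (a : Fin n → Carrier) →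
    vandermonde n (λ i → x * a i) ≈ pow x (triangular n) * vandermonde n a
  vandermonde-scale zero    x a = sym (*-identityˡ 1#)
  vandermonde-scale (suc n) x a = begin
    vandermonde (suc n) (λ i → x * a i)
      ≈⟨ prodLt-suc n (λ i j → x * a i - x * a j) ⟩
    prodFin n (λ j → x * a zero - x * a (suc j)) * vandermonde n (λ i → x * a (suc i))
      ≈⟨ *-cong (prodFin-cong n (λ j → sym (x[y-z]≈xy-xz x (a zero) (a (suc j))))) (vandermonde-scale n x (λ i → a (suc i))) ⟩
    prodFin n (λ j → x * (a zero - a (suc j))) * (pow x (triangular n) * vandermonde n (λ i → a (suc i)))
      ≈⟨ *-congʳ (prodFin-scale n x _) ⟩
    (pow x n * prodFin n (λ j → a zero - a (suc j))) * (pow x (triangular n) * vandermonde n (λ i → a (suc i)))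
      ≈⟨ *-interchange _ _ _ _ ⟩
    (pow x n * pow x (triangular n)) * (prodFin n (λ j → a zero - a (suc j)) * vandermonde n (λ i → a (suc i)))
      ≈⟨ *-cong (pow-+ x n (triangular n)) (prodLt-suc n (λ i j → a i - a j)) ⟨
    pow x (triangular (suc n)) * vandermonde (suc n) a ∎

inject₁≢suc : ∀ {m} (k : Fin m) → inject₁ k ≢ suc k
inject₁≢suc zero    ()
inject₁≢suc (suc k) eq = inject₁≢suc k (suc-injective eq)

punchIn-keepsAdjacent : ∀ {m} (j : Fin (suc (suc m))) (k : Fin (suc m)) → j ≢ inject₁ k → j ≢ suc k →
  ∃ λ k′ → punchIn j (inject₁ k′) ≡ inject₁ k × punchIn j (suc k′) ≡ suc k
punchIn-keepsAdjacent zero    zero    j≢k _     = contradiction ≡.refl j≢k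
punchIn-keepsAdjacent zero    (suc k) _   _     = k , ≡.refl , ≡.refl
punchIn-keepsAdjacent (suc zero) zero _   j≢k+1 = contradiction ≡.refl j≢k+1
punchIn-keepsAdjacent {suc m} (suc (suc j)) zero _ _ = zero , ≡.refl , ≡.refl
punchIn-keepsAdjacent {suc m} (suc j) (suc k) j≢k j≢k+1
  with punchIn-keepsAdjacent j k (λ eq → j≢k (≡.cong suc eq)) (λ eq → j≢k+1 (≡.cong suc eq))
... | k′ , eq₁ , eq₂ = suc k′ , ≡.cong suc eq₁ , ≡.cong suc eq₂

punchIn-adjacentSwap : ∀ {m} (k l : Fin m) →
  punchIn (inject₁ k) l ≡ punchIn (suc k) l ⊎ (punchIn (inject₁ k) l ≡ suc k × punchIn (suc k) l ≡ inject₁ k)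
punchIn-adjacentSwap zero    zero    = inj₂ (≡.refl , ≡.refl)
punchIn-adjacentSwap zero    (suc l) = inj₁ ≡.refl
punchIn-adjacentSwap (suc k) zero    = inj₁ ≡.refl
punchIn-adjacentSwap (suc k) (suc l) with punchIn-adjacentSwap k l
... | inj₁ eq          = inj₁ (≡.cong suc eq)
... | inj₂ (eq₁ , eq₂) = inj₂ (≡.cong suc eq₁ , ≡.cong suc eq₂)

module Determinants {c ℓ : Level} (F : Field c ℓ) where
  open Field F hiding (zero)
  open FieldOps F
  open FiniteSumsAndProducts F
  open ℤ-CoefficientRingSolver commutativeRing
  open import Algebra.Properties.Ring ring using (-‿involutive; -0#≈0#)
  open import Relation.Binary.Reasoning.Setoid setoid

  Matrix : ℕ → Set c
  Matrix n = Fin n → Fin n → Carrier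

  minor : ∀ {n} → Matrix (suc n) → Fin (suc n) → Matrix n
  minor M j i l = M (suc i) (punchIn j l)

  laplaceTerm : ∀ {n} → Matrix (suc n) → Fin (suc n) → Carrier
  laplaceTerm {n} M j = sgn j * (M zero j * det n (minor M j))

  det-cong : ∀ n {M M′ : Matrix n} → (∀ i j → M i j ≈ M′ i j) → det n M ≈ det n M′
  det-cong zero    M≈M′ = refl
  det-cong (suc n) M≈M′ = sumFin-cong (suc n) (λ j →
    *-congˡ {sgn j} (*-cong (M≈M′ zero j) (det-cong n (λ i l → M≈M′ (suc i) (punchIn j l)))))

  det-sparseFirstRow : ∀ n (M : Matrix (suc n)) → (∀ j → j ≢ zero → M zero j ≈ 0#) →
    det (suc n) M ≈ M zero zero * det n (λ i l → M (suc i) (suc l))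
  det-sparseFirstRow n M row≈0 = begin
    det (suc n) M                                         ≈⟨ +-cong (*-identityˡ _) (sumFin-zero n vanish) ⟩
    M zero zero * det n (λ i l → M (suc i) (suc l)) + 0#  ≈⟨ +-identityʳ _ ⟩
    M zero zero * det n (λ i l → M (suc i) (suc l))       ∎
    where
    vanish : ∀ j → laplaceTerm M (suc j) ≈ 0#
    vanish j = trans (*-congˡ (trans (*-congʳ (row≈0 (suc j) (λ ()))) (zeroˡ _))) (zeroʳ _)

  det-scaleColumns : ∀ n (r : Fin n → Carrier) (M : Matrix n) →
    det n (λ i l → M i l * r l) ≈ prodFin n r * det n M
  det-scaleColumns zero    r M = sym (*-identityˡ 1#)
  det-scaleColumns (suc n) r M = begin
    det (suc n) (λ i l → M i l * r l)
      ≈⟨ sumFin-cong (suc n) (λ j → *-congˡ {sgn j} (*-congˡ {M zero j * r j}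
           (det-scaleColumns n (λ l → r (punchIn j l)) (minor M j)))) ⟩
    sumFin (suc n) (λ j → sgn j * ((M zero j * r j) * (prodFin n (λ l → r (punchIn j l)) * det n (minor M j))))
      ≈⟨ sumFin-cong (suc n) (λ j → trans (regroup (sgn j) (M zero j) (r j) _ (det n (minor M j)))
           (*-congʳ (sym (prodFin-remove n r j)))) ⟩
    sumFin (suc n) (λ j → prodFin (suc n) r * laplaceTerm M j)
      ≈⟨ *-distribˡ-sumFin (suc n) (prodFin (suc n) r) (laplaceTerm M) ⟩
    prodFin (suc n) r * det (suc n) M ∎
    where
    regroup : ∀ s a b p d → s * ((a * b) * (p * d)) ≈ (b * p) * (s * (a * d))
    regroup = solve 5 (λ s a b p d → s :* ((a :* b) :* (p :* d)) := (b :* p) :* (s :* (a :* d))) refl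

  minor-cong : ∀ {n} {M M′ : Matrix (suc n)} j → (∀ i l → l ≢ j → M i l ≈ M′ i l) →
    ∀ i l → minor M j i l ≈ minor M′ j i l
  minor-cong j M≈M′ i l = M≈M′ (suc i) (punchIn j l) (punchInᵢ≢i j l)

  det-linear : ∀ n (M₁ M₂ M : Matrix n) (j : Fin n) (a : Carrier) →
    (∀ i l → l ≢ j → M₁ i l ≈ M i l) → (∀ i l → l ≢ j → M₂ i l ≈ M i l) →
    (∀ i → M i j ≈ M₁ i j + a * M₂ i j) → det n M ≈ det n M₁ + a * det n M₂
  det-linear (suc n) M₁ M₂ M j a M₁≈M M₂≈M column-j = begin
    sumFin (suc n) (laplaceTerm M)
      ≈⟨ sumFin-cong (suc n) term ⟩
    sumFin (suc n) (λ k → laplaceTerm M₁ k + a * laplaceTerm M₂ k)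
      ≈⟨ sumFin-distrib-+ (suc n) (laplaceTerm M₁) (λ k → a * laplaceTerm M₂ k) ⟩
    det (suc n) M₁ + sumFin (suc n) (λ k → a * laplaceTerm M₂ k)
      ≈⟨ +-congˡ (*-distribˡ-sumFin (suc n) a (laplaceTerm M₂)) ⟩
    det (suc n) M₁ + a * det (suc n) M₂ ∎
    where
    term : ∀ k → laplaceTerm M k ≈ laplaceTerm M₁ k + a * laplaceTerm M₂ k
    term k with k ≟ j
    ... | yes ≡.refl = begin
      sgn k * (M zero k * det n (minor M k))
        ≈⟨ *-congˡ (*-cong (column-j zero) (det-cong n (λ i l → sym (minor-cong k M₁≈M i l)))) ⟩
      sgn k * ((M₁ zero k + a * M₂ zero k) * det n (minor M₁ k))
        ≈⟨ solve 5 (λ s x y d a → s :* ((x :+ a :* y) :* d) := s :* (x :* d) :+ a :* (s :* (y :* d))) refl _ _ _ _ a ⟩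
      laplaceTerm M₁ k + a * (sgn k * (M₂ zero k * det n (minor M₁ k)))
        ≈⟨ +-congˡ (*-congˡ (*-congˡ (*-congˡ (det-cong n (λ i l →
             trans (minor-cong k M₁≈M i l) (sym (minor-cong k M₂≈M i l))))))) ⟩
      laplaceTerm M₁ k + a * laplaceTerm M₂ k ∎
    ... | no k≢j = begin
      sgn k * (M zero k * det n (minor M k))
        ≈⟨ *-congˡ (*-congˡ minor-linear) ⟩
      sgn k * (M zero k * (det n (minor M₁ k) + a * det n (minor M₂ k)))
        ≈⟨ solve 5 (λ s x d₁ d₂ a → s :* (x :* (d₁ :+ a :* d₂)) := s :* (x :* d₁) :+ a :* (s :* (x :* d₂))) refl _ _ _ _ a ⟩
      sgn k * (M zero k * det n (minor M₁ k)) + a * (sgn k * (M zero k * det n (minor M₂ k)))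
        ≈⟨ +-cong (*-congˡ (*-congʳ (sym (M₁≈M zero k k≢j)))) (*-congˡ (*-congˡ (*-congʳ (sym (M₂≈M zero k k≢j))))) ⟩
      laplaceTerm M₁ k + a * laplaceTerm M₂ k ∎
      where
      j′ = punchOut k≢j
      punchIn-j′ : punchIn k j′ ≡ j
      punchIn-j′ = punchIn-punchOut k≢j
      avoids-j : ∀ l → l ≢ j′ → punchIn k l ≢ j
      avoids-j l l≢j′ eq = l≢j′ (punchIn-injective k l j′ (≡.trans eq (≡.sym punchIn-j′)))
      minor-linear : det n (minor M k) ≈ det n (minor M₁ k) + a * det n (minor M₂ k)
      minor-linear = det-linear n (minor M₁ k) (minor M₂ k) (minor M k) j′ a
        (λ i l l≢j′ → M₁≈M (suc i) (punchIn k l) (avoids-j l l≢j′))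
        (λ i l l≢j′ → M₂≈M (suc i) (punchIn k l) (avoids-j l l≢j′))
        (λ i → ≡.subst (λ x → M (suc i) x ≈ M₁ (suc i) x + a * M₂ (suc i) x) (≡.sym punchIn-j′) (column-j (suc i)))

  sgn-inject₁ : ∀ {m} (k : Fin m) → sgn (inject₁ k) ≡ sgn k
  sgn-inject₁ zero    = ≡.refl
  sgn-inject₁ (suc k) = ≡.cong -_ (sgn-inject₁ k)

  det-equalAdjacentColumns : ∀ m (M : Matrix (suc m)) (k : Fin m) →
    (∀ i → M i (inject₁ k) ≈ M i (suc k)) → det (suc m) M ≈ 0#
  det-equalAdjacentColumns (suc m) M k equal = sumFin-cancellingPair (suc m) (laplaceTerm M) k others pair
    where
    others : ∀ j → j ≢ inject₁ k → j ≢ suc k → laplaceTerm M j ≈ 0#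
    others j j≢k j≢k+1 with punchIn-keepsAdjacent j k j≢k j≢k+1
    ... | k′ , eq₁ , eq₂ = trans (*-congˡ (trans (*-congˡ minor≈0) (zeroʳ _))) (zeroʳ _)
      where
      minor≈0 : det (suc m) (minor M j) ≈ 0#
      minor≈0 = det-equalAdjacentColumns m (minor M j) k′ (λ i →
        ≡.subst₂ (λ x y → M (suc i) x ≈ M (suc i) y) (≡.sym eq₁) (≡.sym eq₂) (equal (suc i)))
    minors-agree : ∀ i l → minor M (inject₁ k) i l ≈ minor M (suc k) i l
    minors-agree i l with punchIn-adjacentSwap k l
    ... | inj₁ eq          = reflexive (≡.cong (M (suc i)) eq)
    ... | inj₂ (eq₁ , eq₂) = begin
      M (suc i) (punchIn (inject₁ k) l)  ≡⟨ ≡.cong (M (suc i)) eq₁ ⟩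
      M (suc i) (suc k)                  ≈⟨ equal (suc i) ⟨
      M (suc i) (inject₁ k)              ≡⟨ ≡.cong (M (suc i)) eq₂ ⟨
      M (suc i) (punchIn (suc k) l)      ∎
    pair : laplaceTerm M (inject₁ k) + laplaceTerm M (suc k) ≈ 0#
    pair = begin
      sgn (inject₁ k) * (M zero (inject₁ k) * det (suc m) (minor M (inject₁ k))) + laplaceTerm M (suc k)
        ≈⟨ +-congʳ (*-cong (reflexive (sgn-inject₁ k)) (*-cong (equal zero) (det-cong (suc m) minors-agree))) ⟩
      sgn k * x + (- sgn k) * x  ≈⟨ solve 2 (λ s x → s :* x :+ (:- s) :* x := 0ᴾ) refl (sgn k) x ⟩
      0#                         ∎
      where x = M zero (suc k) * det (suc m) (minor M (suc k))

  alternating⇒antisymmetric : ∀ {a} {A : Set a} (_∙_ : A → A → A) (P : A → A → Carrier) →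
    (∀ x x′ y → P (x ∙ x′) y ≈ P x y + P x′ y) → (∀ x y y′ → P x (y ∙ y′) ≈ P x y + P x y′) →
    (∀ x → P x x ≈ 0#) → ∀ x y → P x y + P y x ≈ 0#
  alternating⇒antisymmetric _∙_ P additiveˡ additiveʳ alternating x y = begin
    P x y + P y x
      ≈⟨ solve 4 (λ a b c d → b :+ c := (a :+ b) :+ (c :+ d) :- (a :+ d)) refl (P x x) (P x y) (P y x) (P y y) ⟩
    (P x x + P x y) + (P y x + P y y) - (P x x + P y y)
      ≈⟨ +-cong (+-cong (sym (additiveʳ x x y)) (sym (additiveʳ y x y))) (-‿cong (+-cong (alternating x) (alternating y))) ⟩
    (P x (x ∙ y) + P y (x ∙ y)) - (0# + 0#)   ≈⟨ +-cong (sym (additiveˡ x y (x ∙ y))) (-‿cong (+-identityˡ 0#)) ⟩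
    P (x ∙ y) (x ∙ y) - 0#                    ≈⟨ +-congʳ (alternating (x ∙ y)) ⟩
    0# - 0#                                   ≈⟨ -‿inverseʳ 0# ⟩
    0#                                        ∎

  withColumn : ∀ {n} → Matrix n → Fin n → (Fin n → Carrier) → Matrix n
  withColumn M k x i = updateAt (M i) k (λ _ → x i)

  withColumn-≡ : ∀ {n} (M : Matrix n) k x i → withColumn M k x i k ≡ x i
  withColumn-≡ M k x i = updateAt-updates k (M i)

  withColumn-≢ : ∀ {n} (M : Matrix n) k x i {l} → l ≢ k → withColumn M k x i l ≡ M i l
  withColumn-≢ M k x i {l} l≢k = updateAt-minimal l k (M i) l≢k

  module AdjacentColumns {m} (M : Matrix (suc m)) (k : Fin m) where

    a b : Fin (suc m)
    a = inject₁ k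
    b = suc k

    b≢a : b ≢ a
    b≢a eq = inject₁≢suc k (≡.sym eq)

    colₐ colᵦ : Fin (suc m) → Carrier
    colₐ i = M i a
    colᵦ i = M i b

    W : (x y : Fin (suc m) → Carrier) → Matrix (suc m)
    W x y = withColumn (withColumn M b y) a x

    W-a : ∀ x y i → W x y i a ≡ x i
    W-a x y i = withColumn-≡ (withColumn M b y) a x i

    W-b : ∀ x y i → W x y i b ≡ y i
    W-b x y i = ≡.trans (withColumn-≢ (withColumn M b y) a x i b≢a) (withColumn-≡ M b y i)

    W-other : ∀ x y i {l} → l ≢ a → l ≢ b → W x y i l ≡ M i l
    W-other x y i l≢a l≢b = ≡.trans (withColumn-≢ (withColumn M b y) a x i l≢a) (withColumn-≢ M b y i l≢b)

    W-offₐ : ∀ x x′ y i l → l ≢ a → W x y i l ≡ W x′ y i l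
    W-offₐ x x′ y i l l≢a =
      ≡.trans (withColumn-≢ (withColumn M b y) a x i l≢a) (≡.sym (withColumn-≢ (withColumn M b y) a x′ i l≢a))

    W-offᵦ : ∀ x y y′ i l → l ≢ b → W x y i l ≡ W x y′ i l
    W-offᵦ x y y′ i l l≢b with l ≟ a
    ... | yes ≡.refl = ≡.trans (W-a x y i) (≡.sym (W-a x y′ i))
    ... | no l≢a     = ≡.trans (W-other x y i l≢a l≢b) (≡.sym (W-other x y′ i l≢a l≢b))

    M≈W : ∀ i l → M i l ≈ W colₐ colᵦ i l
    M≈W i l with l ≟ a | l ≟ b
    ... | yes ≡.refl | _          = reflexive (≡.sym (W-a colₐ colᵦ i))
    ... | no _       | yes ≡.refl = reflexive (≡.sym (W-b colₐ colᵦ i))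
    ... | no l≢a     | no l≢b     = reflexive (≡.sym (W-other colₐ colᵦ i l≢a l≢b))

    private
      split-column : ∀ {w u v s t : Carrier} → w ≡ s + t → u ≡ s → v ≡ t → w ≈ u + 1# * v
      split-column ≡.refl ≡.refl ≡.refl = +-congˡ (sym (*-identityˡ _))

    det-W-additiveˡ : ∀ x x′ y → det (suc m) (W (λ i → x i + x′ i) y) ≈ det (suc m) (W x y) + det (suc m) (W x′ y)
    det-W-additiveˡ x x′ y = trans (det-linear (suc m) (W x y) (W x′ y) (W x+x′ y) a 1#
      (λ i l l≢a → reflexive (W-offₐ x x+x′ y i l l≢a)) (λ i l l≢a → reflexive (W-offₐ x′ x+x′ y i l l≢a))
      (λ i → split-column (W-a x+x′ y i) (W-a x y i) (W-a x′ y i))) (+-congˡ (*-identityˡ _))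
      where x+x′ = λ i → x i + x′ i

    det-W-additiveʳ : ∀ x y y′ → det (suc m) (W x (λ i → y i + y′ i)) ≈ det (suc m) (W x y) + det (suc m) (W x y′)
    det-W-additiveʳ x y y′ = trans (det-linear (suc m) (W x y) (W x y′) (W x y+y′) b 1#
      (λ i l l≢b → reflexive (W-offᵦ x y y+y′ i l l≢b)) (λ i l l≢b → reflexive (W-offᵦ x y′ y+y′ i l l≢b))
      (λ i → split-column (W-b x y+y′ i) (W-b x y i) (W-b x y′ i))) (+-congˡ (*-identityˡ _))
      where y+y′ = λ i → y i + y′ i

    det-W-alternating : ∀ x → det (suc m) (W x x) ≈ 0#
    det-W-alternating x = det-equalAdjacentColumns m (W x x) k (λ i → reflexive (≡.trans (W-a x x i) (≡.sym (W-b x x i))))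

    swapped : Matrix (suc m)
    swapped = W colᵦ colₐ

  det-swapAdjacentColumns : ∀ m (M : Matrix (suc m)) (k : Fin m) →
    det (suc m) (AdjacentColumns.swapped M k) ≈ - det (suc m) M
  det-swapAdjacentColumns m M k = begin
    det (suc m) swapped                                      ≈⟨ solve 2 (λ x y → y := (x :+ y) :- x) refl (det (suc m) M) _ ⟩
    (det (suc m) M + det (suc m) swapped) - det (suc m) M    ≈⟨ +-congʳ (trans (+-congʳ (det-cong (suc m) M≈W)) antisymmetric) ⟩
    0# - det (suc m) M                                       ≈⟨ +-identityˡ _ ⟩
    - det (suc m) M                                          ∎
    where
    open AdjacentColumns M k
    antisymmetric : det (suc m) (W colₐ colᵦ) + det (suc m) (W colᵦ colₐ) ≈ 0#
    antisymmetric = alternating⇒antisymmetric (λ x y i → x i + y i) (λ x y → det (suc m) (W x y))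
      det-W-additiveˡ det-W-additiveʳ det-W-alternating colₐ colᵦ

  det-equalColumns₀ : ∀ m (M : Matrix (suc m)) (j : Fin m) → (∀ i → M i zero ≈ M i (suc j)) → det (suc m) M ≈ 0#
  det-equalColumns₀ m M j = go m (toℕ j) M j ≡.refl
    where
    -- Recursion on d = toℕ j: the swap moves the copy of column 0 from suc (suc j) to suc (inject₁ j),
    -- and inject₁ j is not a structural subterm of suc j.
    go : ∀ m d (M : Matrix (suc m)) (j : Fin m) → toℕ j ≡ d → (∀ i → M i zero ≈ M i (suc j)) → det (suc m) M ≈ 0#
    go (suc m) _       M zero    _     equal = det-equalAdjacentColumns (suc m) M zero equal
    go (suc m) (suc d) M (suc j) toℕ≡d equal = begin
      det (suc (suc m)) M          ≈⟨ -‿involutive _ ⟨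
      - (- det (suc (suc m)) M)    ≈⟨ -‿cong (det-swapAdjacentColumns (suc m) M (suc j)) ⟨
      - det (suc (suc m)) swapped
        ≈⟨ -‿cong (go (suc m) d swapped (inject₁ j) (≡.trans (toℕ-inject₁ j) (ℕ.suc-injective toℕ≡d)) equal′) ⟩
      - 0#                         ≈⟨ -0#≈0# ⟩
      0#                           ∎
      where
      open AdjacentColumns M (suc j)
      equal′ : ∀ i → swapped i zero ≈ swapped i a
      equal′ i = begin
        swapped i zero  ≡⟨ W-other colᵦ colₐ i (λ ()) (λ ()) ⟩
        M i zero        ≈⟨ equal i ⟩
        M i b           ≡⟨ W-a colᵦ colₐ i ⟨
        swapped i a     ∎

  det-addColumn₀ : ∀ m (M M′ : Matrix (suc m)) (j : Fin m) (a : Carrier) →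
    (∀ i l → l ≢ suc j → M′ i l ≈ M i l) → (∀ i → M′ i (suc j) ≈ M i (suc j) + a * M i zero) →
    det (suc m) M′ ≈ det (suc m) M
  det-addColumn₀ m M M′ j a M′≈M column-j = begin
    det (suc m) M′
      ≈⟨ det-linear (suc m) M M₀ M′ (suc j) a
           (λ i l l≢j → sym (M′≈M i l l≢j))
           (λ i l l≢j → trans (reflexive (withColumn-≢ M (suc j) col₀ i l≢j)) (sym (M′≈M i l l≢j)))
           (λ i → trans (column-j i) (+-congˡ (*-congˡ (reflexive (≡.sym (withColumn-≡ M (suc j) col₀ i)))))) ⟩
    det (suc m) M + a * det (suc m) M₀       ≈⟨ +-congˡ (trans (*-congˡ M₀≈0) (zeroʳ a)) ⟩
    det (suc m) M + 0#                       ≈⟨ +-identityʳ _ ⟩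
    det (suc m) M                            ∎
    where
    col₀ : Fin (suc m) → Carrier
    col₀ i = M i zero
    M₀ = withColumn M (suc j) col₀
    M₀≈0 : det (suc m) M₀ ≈ 0#
    M₀≈0 = det-equalColumns₀ m M₀ j (λ i →
      reflexive (≡.trans (withColumn-≢ M (suc j) col₀ i (λ ())) (≡.sym (withColumn-≡ M (suc j) col₀ i))))

  addColumn₀Multiples : ∀ {m} → Matrix (suc m) → (Fin m → Carrier) → Matrix (suc m)
  addColumn₀Multiples M c i zero    = M i zero
  addColumn₀Multiples M c i (suc l) = M i (suc l) + c l * M i zero

  det-addColumn₀Multiples : ∀ m (M : Matrix (suc m)) (c : Fin m → Carrier) →
    det (suc m) (addColumn₀Multiples M c) ≈ det (suc m) M
  det-addColumn₀Multiples m M c = supportBelow m ℕ.≤-refl c (λ l m≤l → contradiction (toℕ<n l) (ℕ.≤⇒≯ m≤l))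
    where
    -- Induction on a bound t for the support of c: each step clears the multiplier at position t.
    supportBelow : ∀ t → t ℕ.≤ m → (c : Fin m → Carrier) → (∀ l → t ℕ.≤ toℕ l → c l ≈ 0#) →
      det (suc m) (addColumn₀Multiples M c) ≈ det (suc m) M
    supportBelow zero _ c c≈0 = det-cong (suc m) unchanged
      where
      unchanged : ∀ i l → addColumn₀Multiples M c i l ≈ M i l
      unchanged i zero    = refl
      unchanged i (suc l) = trans (+-congˡ (trans (*-congʳ (c≈0 l ℕ.z≤n)) (zeroˡ _))) (+-identityʳ _)
    supportBelow (suc t) t<m c c≈0 = trans
      (det-addColumn₀ m (addColumn₀Multiples M c′) (addColumn₀Multiples M c) l₀ (c l₀) agree column-l₀)
      (supportBelow t (ℕ.<⇒≤ t<m) c′ c′≈0)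
      where
      l₀ = fromℕ< t<m
      c′ : Fin m → Carrier
      c′ = updateAt c l₀ (λ _ → 0#)
      c′≈0 : ∀ l → t ℕ.≤ toℕ l → c′ l ≈ 0#
      c′≈0 l t≤l with l ≟ l₀
      ... | yes ≡.refl = reflexive (updateAt-updates l₀ c)
      ... | no l≢l₀    = trans (reflexive (updateAt-minimal l l₀ c l≢l₀))
        (c≈0 l (ℕ.≤∧≢⇒< t≤l (λ t≡l → l≢l₀ (toℕ-injective (≡.trans (≡.sym t≡l) (≡.sym (toℕ-fromℕ< t<m)))))))
      agree : ∀ i l → l ≢ suc l₀ → addColumn₀Multiples M c i l ≈ addColumn₀Multiples M c′ i l
      agree i zero    _        = refl
      agree i (suc l) l+1≢l₀+1 = +-congˡ (*-congʳ (reflexive (≡.sym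
        (updateAt-minimal l l₀ c (λ l≡l₀ → l+1≢l₀+1 (≡.cong suc l≡l₀))))))
      column-l₀ : ∀ i → addColumn₀Multiples M c i (suc l₀)
                      ≈ addColumn₀Multiples M c′ i (suc l₀) + c l₀ * M i zero
      column-l₀ i = +-congʳ (sym (trans (+-congˡ (trans (*-congʳ (reflexive (updateAt-updates l₀ c))) (zeroˡ _))) (+-identityʳ _)))

module CauchyDeterminant {c ℓ : Level} (F : Field c ℓ) where
  open Field F hiding (zero)
  open FieldOps F
  open FieldArithmetic F
  open FiniteSumsAndProducts F
  open PairProducts F
  open Determinants F
  open ℤ-CoefficientRingSolver commutativeRing
  open import Algebra.Properties.CommutativeSemigroup *-commutativeSemigroup using () renaming (interchange to *-interchange)
  open import Relation.Binary.Reasoning.Setoid setoid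

  cauchyProduct : ∀ n → (x y : Fin n → Carrier) → Carrier
  cauchyProduct n x y = prodFin n (λ i → prodFin n (λ j → 1# - x i * y j))

  -- L · [(1 − xᵢ yₗ)⁻¹] for L lower bidiagonal, with diagonal B and subdiagonal A.
  bidiagonalCauchy : ∀ {m} (A : Fin m → Carrier) (B x y : Fin (suc m) → Carrier) → Matrix (suc m)
  bidiagonalCauchy A B x y zero    l = B zero * (1# - x zero * y l) ⁻¹
  bidiagonalCauchy A B x y (suc i) l = A i * (1# - x (inject₁ i) * y l) ⁻¹ + B (suc i) * (1# - x (suc i) * y l) ⁻¹

  -- (1 − xᵣy₀)(1 − x₀yₗ) − (1 − x₀y₀)(1 − xᵣyₗ) = (xᵣ − x₀)(yₗ − y₀)
  cauchy-columnElimination : ∀ xᵣ x₀ yₗ y₀ kᵣₗ kᵣ₀ k₀ₗ →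
    (1# - xᵣ * yₗ) * kᵣₗ ≈ 1# → (1# - xᵣ * y₀) * kᵣ₀ ≈ 1# → (1# - x₀ * yₗ) * k₀ₗ ≈ 1# →
    kᵣₗ + (- ((1# - x₀ * y₀) * k₀ₗ)) * kᵣ₀ ≈ ((xᵣ - x₀) * kᵣ₀) * ((yₗ - y₀) * k₀ₗ) * kᵣₗ
  cauchy-columnElimination xᵣ x₀ yₗ y₀ kᵣₗ kᵣ₀ k₀ₗ eᵣₗkᵣₗ≈1 eᵣ₀kᵣ₀≈1 e₀ₗk₀ₗ≈1 = begin
    kᵣₗ + (- ((1# - x₀ * y₀) * k₀ₗ)) * kᵣ₀
      ≈⟨ +-cong (sym (trans (*-cong (*-congˡ eᵣ₀kᵣ₀≈1) e₀ₗk₀ₗ≈1) (trans (*-identityʳ _) (*-identityʳ _))))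
                (sym (trans (*-congˡ eᵣₗkᵣₗ≈1) (*-identityʳ _))) ⟩
    kᵣₗ * ((1# - xᵣ * y₀) * kᵣ₀) * ((1# - x₀ * yₗ) * k₀ₗ)
      + (- ((1# - x₀ * y₀) * k₀ₗ)) * kᵣ₀ * ((1# - xᵣ * yₗ) * kᵣₗ)
      ≈⟨ solve 7 (λ xᵣ x₀ yₗ y₀ kᵣₗ kᵣ₀ k₀ₗ →
           kᵣₗ :* ((1ᴾ :+ :- (xᵣ :* y₀)) :* kᵣ₀) :* ((1ᴾ :+ :- (x₀ :* yₗ)) :* k₀ₗ)
             :+ (:- ((1ᴾ :+ :- (x₀ :* y₀)) :* k₀ₗ)) :* kᵣ₀ :* ((1ᴾ :+ :- (xᵣ :* yₗ)) :* kᵣₗ)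
           := ((xᵣ :+ :- x₀) :* kᵣ₀) :* ((yₗ :+ :- y₀) :* k₀ₗ) :* kᵣₗ) refl xᵣ x₀ yₗ y₀ kᵣₗ kᵣ₀ k₀ₗ ⟩
    ((xᵣ - x₀) * kᵣ₀) * ((yₗ - y₀) * k₀ₗ) * kᵣₗ ∎

  -- Adding multipliers l times column 0 to column l + 1 clears the first row of M; the remaining
  -- entries become those of reduced, with column l scaled by columnFactor l (cauchy-columnElimination).
  module Elimination {m} (A : Fin (suc m) → Carrier) (B x y : Fin (suc (suc m)) → Carrier)
                     (1-xy≉0 : ∀ i j → ¬ (1# - x i * y j ≈ 0#)) where

    M : Matrix (suc (suc m))
    M = bidiagonalCauchy A B x y

    K : Fin (suc (suc m)) → Fin (suc (suc m)) → Carrier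
    K i j = (1# - x i * y j) ⁻¹

    eK≈1 : ∀ i j → (1# - x i * y j) * K i j ≈ 1#
    eK≈1 i j = ⁻¹-inverse _ (1-xy≉0 i j)

    rowFactor : Fin (suc (suc m)) → Carrier
    rowFactor r = (x r - x zero) * K r zero

    columnFactor : Fin (suc m) → Carrier
    columnFactor l = (y (suc l) - y zero) * K zero (suc l)

    multipliers : Fin (suc m) → Carrier
    multipliers l = - ((1# - x zero * y zero) * K zero (suc l))

    A′ : Fin m → Carrier
    A′ i = A (suc i) * rowFactor (suc (inject₁ i))

    B′ x′ y′ : Fin (suc m) → Carrier
    B′ i = B (suc i) * rowFactor (suc i)
    x′ i = x (suc i)
    y′ j = y (suc j)

    reduced : Matrix (suc m)
    reduced = bidiagonalCauchy A′ B′ x′ y′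

    M′ : Matrix (suc (suc m))
    M′ = addColumn₀Multiples M multipliers

    M′-firstRow : ∀ j → j ≢ zero → M′ zero j ≈ 0#
    M′-firstRow zero    0≢0 = contradiction ≡.refl 0≢0
    M′-firstRow (suc l) _   = begin
      B zero * K zero (suc l) + (- (e₀₀ * K zero (suc l))) * (B zero * K zero zero)
        ≈⟨ solve 4 (λ b k e k₀₀ → b :* k :+ (:- (e :* k)) :* (b :* k₀₀) := b :* k :+ (:- (b :* k)) :* (e :* k₀₀)) refl
             (B zero) (K zero (suc l)) e₀₀ (K zero zero) ⟩
      B zero * K zero (suc l) + (- (B zero * K zero (suc l))) * (e₀₀ * K zero zero)
        ≈⟨ +-congˡ (trans (*-congˡ (eK≈1 zero zero)) (*-identityʳ _)) ⟩
      B zero * K zero (suc l) - B zero * K zero (suc l)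
        ≈⟨ -‿inverseʳ _ ⟩
      0# ∎
      where e₀₀ = 1# - x zero * y zero

    eliminatedEntry : ∀ r l → K r (suc l) + multipliers l * K r zero ≈ rowFactor r * columnFactor l * K r (suc l)
    eliminatedEntry r l = cauchy-columnElimination (x r) (x zero) (y (suc l)) (y zero) (K r (suc l)) (K r zero) (K zero (suc l))
      (eK≈1 r (suc l)) (eK≈1 r zero) (eK≈1 zero (suc l))

    M′-rowEntry : ∀ i l → M′ (suc i) (suc l)
      ≈ (A i * (rowFactor (inject₁ i) * K (inject₁ i) (suc l)) + B (suc i) * (rowFactor (suc i) * K (suc i) (suc l))) * columnFactor l
    M′-rowEntry i l = begin
      (a * K (inject₁ i) (suc l) + b * K (suc i) (suc l)) + μ * (a * K (inject₁ i) zero + b * K (suc i) zero)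
        ≈⟨ solve 7 (λ a b k₁ k₂ k₁₀ k₂₀ μ → (a :* k₁ :+ b :* k₂) :+ μ :* (a :* k₁₀ :+ b :* k₂₀)
                                        := a :* (k₁ :+ μ :* k₁₀) :+ b :* (k₂ :+ μ :* k₂₀)) refl
             a b (K (inject₁ i) (suc l)) (K (suc i) (suc l)) (K (inject₁ i) zero) (K (suc i) zero) μ ⟩
      a * (K (inject₁ i) (suc l) + μ * K (inject₁ i) zero) + b * (K (suc i) (suc l) + μ * K (suc i) zero)
        ≈⟨ +-cong (*-congˡ (eliminatedEntry (inject₁ i) l)) (*-congˡ (eliminatedEntry (suc i) l)) ⟩
      a * (r₀ * columnFactor l * k₀) + b * (r₁ * columnFactor l * k₁)
        ≈⟨ solve 7 (λ a b r₀ r₁ c k₀ k₁ → a :* (r₀ :* c :* k₀) :+ b :* (r₁ :* c :* k₁)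
                                      := (a :* (r₀ :* k₀) :+ b :* (r₁ :* k₁)) :* c) refl
             a b r₀ r₁ (columnFactor l) k₀ k₁ ⟩
      (a * (r₀ * k₀) + b * (r₁ * k₁)) * columnFactor l ∎
      where
      a = A i
      b = B (suc i)
      μ = multipliers l
      r₀ = rowFactor (inject₁ i)
      r₁ = rowFactor (suc i)
      k₀ = K (inject₁ i) (suc l)
      k₁ = K (suc i) (suc l)

    reducedRow : ∀ i l → A i * (rowFactor (inject₁ i) * K (inject₁ i) (suc l)) + B (suc i) * (rowFactor (suc i) * K (suc i) (suc l))
                         ≈ reduced i l
    reducedRow zero    l = begin
      A zero * (rowFactor zero * K zero (suc l)) + B (suc zero) * (rowFactor (suc zero) * K (suc zero) (suc l))
        ≈⟨ +-congʳ (trans (*-congˡ (trans (*-congʳ rowFactor₀≈0) (zeroˡ _))) (zeroʳ _)) ⟩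
      0# + B (suc zero) * (rowFactor (suc zero) * K (suc zero) (suc l))
        ≈⟨ trans (+-identityˡ _) (sym (*-assoc _ _ _)) ⟩
      reduced zero l ∎
      where
      rowFactor₀≈0 : rowFactor zero ≈ 0#
      rowFactor₀≈0 = trans (*-congʳ (-‿inverseʳ (x zero))) (zeroˡ _)
    reducedRow (suc i) l = +-cong (sym (*-assoc _ _ _)) (sym (*-assoc _ _ _))

    det-eliminate : det (suc (suc m)) M ≈ (B zero * K zero zero) * (prodFin (suc m) columnFactor * det (suc m) reduced)
    det-eliminate = begin
      det (suc (suc m)) M
        ≈⟨ det-addColumn₀Multiples (suc m) M multipliers ⟨
      det (suc (suc m)) M′
        ≈⟨ det-sparseFirstRow (suc m) M′ M′-firstRow ⟩
      (B zero * K zero zero) * det (suc m) (λ i l → M′ (suc i) (suc l))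
        ≈⟨ *-congˡ (det-cong (suc m) (λ i l → trans (M′-rowEntry i l) (*-congʳ (reducedRow i l)))) ⟩
      (B zero * K zero zero) * det (suc m) (λ i l → reduced i l * columnFactor l)
        ≈⟨ *-congˡ (det-scaleColumns (suc m) columnFactor reduced) ⟩
      (B zero * K zero zero) * (prodFin (suc m) columnFactor * det (suc m) reduced) ∎

    firstRowFactors firstColumnFactors : Carrier
    firstRowFactors    = prodFin (suc m) (λ l → 1# - x zero * y (suc l))
    firstColumnFactors = prodFin (suc m) (λ i → 1# - x (suc i) * y zero)

    cauchyProduct-split : cauchyProduct (suc (suc m)) x y
      ≈ ((1# - x zero * y zero) * firstRowFactors) * (firstColumnFactors * cauchyProduct (suc m) x′ y′)
    cauchyProduct-split = *-congˡ (prodFin-distrib-* (suc m) (λ i → 1# - x (suc i) * y zero)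
      (λ i → prodFin (suc m) (λ l → 1# - x (suc i) * y (suc l))))

    cancel : ∀ {e k} d → e * k ≈ 1# → e * (d * k) ≈ d
    cancel {e} {k} d ek≈1 =
      trans (solve 3 (λ e k d → e :* (d :* k) := d :* (e :* k)) refl e k d) (trans (*-congˡ ek≈1) (*-identityʳ d))

    firstRow-cancel : firstRowFactors * prodFin (suc m) columnFactor ≈ prodFin (suc m) (λ l → y (suc l) - y zero)
    firstRow-cancel = trans (sym (prodFin-distrib-* (suc m) (λ l → 1# - x zero * y (suc l)) columnFactor))
      (prodFin-cong (suc m) (λ l → cancel (y (suc l) - y zero) (eK≈1 zero (suc l))))

    firstColumn-cancel : firstColumnFactors * prodFin (suc m) (λ i → rowFactor (suc i)) ≈ prodFin (suc m) (λ i → x (suc i) - x zero)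
    firstColumn-cancel = trans (sym (prodFin-distrib-* (suc m) (λ i → 1# - x (suc i) * y zero) (λ i → rowFactor (suc i))))
      (prodFin-cong (suc m) (λ i → cancel (x (suc i) - x zero) (eK≈1 (suc i) zero)))

    cauchyProduct-det-reduce : cauchyProduct (suc (suc m)) x y * det (suc (suc m)) M
      ≈ B zero * (prodFin (suc m) (λ l → y (suc l) - y zero)
                  * (firstColumnFactors * (cauchyProduct (suc m) x′ y′ * det (suc m) reduced)))
    cauchyProduct-det-reduce = begin
      cauchyProduct (suc (suc m)) x y * det (suc (suc m)) M
        ≈⟨ *-cong cauchyProduct-split det-eliminate ⟩
      ((e₀₀ * firstRowFactors) * (firstColumnFactors * P′)) * ((B zero * K zero zero) * (C * D′))
        ≈⟨ solve 8 (λ e E E′ P b k C D → ((e :* E) :* (E′ :* P)) :* ((b :* k) :* (C :* D))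
                                      := ((e :* k) :* b) :* ((E :* C) :* (E′ :* (P :* D)))) refl
             e₀₀ firstRowFactors firstColumnFactors P′ (B zero) (K zero zero) C D′ ⟩
      ((e₀₀ * K zero zero) * B zero) * ((firstRowFactors * C) * (firstColumnFactors * (P′ * D′)))
        ≈⟨ *-cong (trans (*-congʳ (eK≈1 zero zero)) (*-identityˡ _)) (*-congʳ firstRow-cancel) ⟩
      B zero * (prodFin (suc m) (λ l → y (suc l) - y zero) * (firstColumnFactors * (P′ * D′))) ∎
      where
      e₀₀ = 1# - x zero * y zero
      P′ = cauchyProduct (suc m) x′ y′
      C = prodFin (suc m) columnFactor
      D′ = det (suc m) reduced

  det-bidiagonalCauchy : ∀ m (A : Fin m → Carrier) (B x y : Fin (suc m) → Carrier) →
    (∀ i j → ¬ (1# - x i * y j ≈ 0#)) →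
    cauchyProduct (suc m) x y * det (suc m) (bidiagonalCauchy A B x y)
      ≈ prodFin (suc m) B * (vandermonde (suc m) x * vandermonde (suc m) y)
  det-bidiagonalCauchy zero A B x y 1-xy≉0 = begin
    ((e * 1#) * 1#) * (1# * ((B zero * e ⁻¹) * 1#) + 0#)
      ≈⟨ solve 3 (λ e b k → ((e :* 1ᴾ) :* 1ᴾ) :* (1ᴾ :* ((b :* k) :* 1ᴾ) :+ 0ᴾ) := b :* (e :* k)) refl e (B zero) (e ⁻¹) ⟩
    B zero * (e * e ⁻¹)
      ≈⟨ *-congˡ (⁻¹-inverse e (1-xy≉0 zero zero)) ⟩
    B zero * 1#
      ≈⟨ solve 1 (λ b → b :* 1ᴾ := (b :* 1ᴾ) :* (((1ᴾ :* 1ᴾ) :* 1ᴾ) :* ((1ᴾ :* 1ᴾ) :* 1ᴾ))) refl (B zero) ⟩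
    prodFin 1 B * (vandermonde 1 x * vandermonde 1 y) ∎
    where e = 1# - x zero * y zero
  det-bidiagonalCauchy (suc m) A B x y 1-xy≉0 = begin
    cauchyProduct (suc (suc m)) x y * det (suc (suc m)) M
      ≈⟨ cauchyProduct-det-reduce ⟩
    B zero * (Y * (firstColumnFactors * (cauchyProduct (suc m) x′ y′ * det (suc m) reduced)))
      ≈⟨ *-congˡ (*-congˡ (*-congˡ (trans IH
           (*-congʳ (prodFin-distrib-* (suc m) (λ i → B (suc i)) (λ i → rowFactor (suc i))))))) ⟩
    B zero * (Y * (firstColumnFactors * ((Bs * R) * (V′x * V′y))))
      ≈⟨ solve 7 (λ b Y E Bs R Vx Vy → b :* (Y :* (E :* ((Bs :* R) :* (Vx :* Vy)))) := (b :* Bs) :* (((E :* R) :* Y) :* (Vx :* Vy))) refl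
           (B zero) Y firstColumnFactors Bs R V′x V′y ⟩
    prodFin (suc (suc m)) B * (((firstColumnFactors * R) * Y) * (V′x * V′y))
      ≈⟨ *-congˡ (*-congʳ (trans (*-congʳ firstColumn-cancel)
           (prodFin-neg² (suc m) (λ i → x (suc i) - x zero) (λ l → y (suc l) - y zero)))) ⟩
    prodFin (suc (suc m)) B
      * ((prodFin (suc m) (λ i → - (x (suc i) - x zero)) * prodFin (suc m) (λ l → - (y (suc l) - y zero))) * (V′x * V′y))
      ≈⟨ *-congˡ (*-congʳ (*-cong (prodFin-cong (suc m) (λ i → neg-sub (x (suc i)) (x zero)))
                                  (prodFin-cong (suc m) (λ l → neg-sub (y (suc l)) (y zero))))) ⟩
    prodFin (suc (suc m)) B * ((Δx * Δy) * (V′x * V′y))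
      ≈⟨ *-congˡ (*-interchange Δx Δy V′x V′y) ⟩
    prodFin (suc (suc m)) B * ((Δx * V′x) * (Δy * V′y))
      ≈⟨ *-congˡ (*-cong (prodLt-suc (suc m) (λ i j → x i - x j)) (prodLt-suc (suc m) (λ i j → y i - y j))) ⟨
    prodFin (suc (suc m)) B * (vandermonde (suc (suc m)) x * vandermonde (suc (suc m)) y) ∎
    where
    open Elimination A B x y 1-xy≉0
    Y = prodFin (suc m) (λ l → y (suc l) - y zero)
    Δx = prodFin (suc m) (λ i → x zero - x (suc i))
    Δy = prodFin (suc m) (λ l → y zero - y (suc l))
    Bs = prodFin (suc m) (λ i → B (suc i))
    R = prodFin (suc m) (λ i → rowFactor (suc i))
    V′x = vandermonde (suc m) x′
    V′y = vandermonde (suc m) y′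
    IH : cauchyProduct (suc m) x′ y′ * det (suc m) reduced ≈ prodFin (suc m) B′ * (V′x * V′y)
    IH = det-bidiagonalCauchy m A′ B′ x′ y′ (λ i j → 1-xy≉0 (suc i) (suc j))
    neg-sub : ∀ a b → - (a - b) ≈ b - a
    neg-sub = solve 2 (λ a b → :- (a :+ :- b) := b :+ :- a) refl

triangular-double : ∀ n → n ℕ.+ (triangular n ℕ.+ triangular n) ≡ n ℕ.* n
triangular-double zero    = ≡.refl
triangular-double (suc n) = begin
  suc n ℕ.+ ((n ℕ.+ t) ℕ.+ (n ℕ.+ t))
    ≡⟨ solve 2 (λ n t → (con 1 :+ n) :+ ((n :+ t) :+ (n :+ t)) := (n :+ (t :+ t)) :+ (con 1 :+ (n :+ n))) ≡.refl n t ⟩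
  (n ℕ.+ (t ℕ.+ t)) ℕ.+ suc (n ℕ.+ n)   ≡⟨ ≡.cong (ℕ._+ suc (n ℕ.+ n)) (triangular-double n) ⟩
  n ℕ.* n ℕ.+ suc (n ℕ.+ n)
    ≡⟨ solve 1 (λ n → n :* n :+ (con 1 :+ (n :+ n)) := (con 1 :+ n) :* (con 1 :+ n)) ≡.refl n ⟩
  suc n ℕ.* suc n                       ∎
  where
  open Data.Nat.Solver.+-*-Solver using (solve; _:+_; _:*_; _:=_; con)
  open ≡.≡-Reasoning
  t = triangular n

module ZFunction {c ℓ : Level} (F : Field c ℓ) where
  open Field F hiding (zero)
  open FieldOps F
  open FieldArithmetic F
  open ℤ-CoefficientRingSolver commutativeRing
  open import Relation.Binary.Reasoning.Setoid setoid

  -- t and w stand for qⁱ and q⁻ⁱ; keeping them apart (with t * w ≈ 1) makes the identities polynomial.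
  numeratorA : (γ s t w : Carrier) → Carrier
  numeratorA γ s t w = (1# - t) * (1# - ((γ * γ) * (s * s)) * w)

  numeratorB : (q γ s t w : Carrier) → Carrier
  numeratorB q γ s t w = ((q * t - γ * q) - γ * (s * s)) + ((γ * γ) * (s * s)) * w

  zfun-partialFractions : ∀ q γ s ξ u₀ t w v → ((s * ξ) * γ) * u₀ ≈ 1# → ¬ (ξ ≈ 0#) → t * w ≈ 1# →
    ¬ (1# - (u₀ * t) * v ≈ 0#) → ¬ (1# - (q * (u₀ * t)) * v ≈ 0#) →
    zfun q γ s ξ (u₀ * t) v
      ≈ numeratorA γ s t w * (1# - (u₀ * t) * v) ⁻¹ + numeratorB q γ s t w * (1# - (q * (u₀ * t)) * v) ⁻¹
  zfun-partialFractions q γ s ξ u₀ t w v sξγu₀≈1 ξ≉0 tw≈1 E₁≉0 E₂≉0 = begin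
    numerator * (E₁ * E₂) ⁻¹
      ≈⟨ *-cong numerator≈ (⁻¹-distrib-* E₁≉0 E₂≉0) ⟩
    (a * E₂ + b * E₁) * (E₁ ⁻¹ * E₂ ⁻¹)
      ≈⟨ solve 6 (λ a b e₁ e₂ k₁ k₂ → (a :* e₂ :+ b :* e₁) :* (k₁ :* k₂)
                                    := a :* (k₁ :* (e₂ :* k₂)) :+ b :* ((e₁ :* k₁) :* k₂)) refl
           a b E₁ E₂ (E₁ ⁻¹) (E₂ ⁻¹) ⟩
    a * (E₁ ⁻¹ * (E₂ * E₂ ⁻¹)) + b * ((E₁ * E₁ ⁻¹) * E₂ ⁻¹)
      ≈⟨ +-cong (*-congˡ (trans (*-congˡ (⁻¹-inverse E₂ E₂≉0)) (*-identityʳ _)))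
                (*-congˡ (trans (*-congʳ (⁻¹-inverse E₁ E₁≉0)) (*-identityˡ _))) ⟩
    a * E₁ ⁻¹ + b * E₂ ⁻¹ ∎
    where
    a = numeratorA γ s t w
    b = numeratorB q γ s t w
    E₁ = 1# - (u₀ * t) * v
    E₂ = 1# - (q * (u₀ * t)) * v
    numerator = ((1# - γ) * (q - γ * (s * s))) * E₁ + ((1# - q) * (1# - ((γ * ξ) * s) * (u₀ * t))) * (1# - ((γ * ξ ⁻¹) * s) * v)
    γξsu₀t≈t : ((γ * ξ) * s) * (u₀ * t) ≈ t
    γξsu₀t≈t = trans
      (solve 5 (λ γ ξ s u₀ t → ((γ :* ξ) :* s) :* (u₀ :* t) := (((s :* ξ) :* γ) :* u₀) :* t) refl γ ξ s u₀ t)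
                     (trans (*-congʳ sξγu₀≈1) (*-identityˡ t))
    ξ⁻¹≈sγu₀ : ξ ⁻¹ ≈ (s * γ) * u₀
    ξ⁻¹≈sγu₀ = ⁻¹-unique ξ≉0
      (trans (solve 4 (λ ξ s γ u₀ → ξ :* ((s :* γ) :* u₀) := ((s :* ξ) :* γ) :* u₀) refl ξ s γ u₀) sξγu₀≈1)
    numerator≈ : numerator ≈ a * E₂ + b * E₁
    numerator≈ = begin
      numerator
        ≈⟨ +-congˡ (*-cong (*-congˡ (+-congˡ (-‿cong γξsu₀t≈t)))
                           (+-congˡ (-‿cong (*-congʳ (*-congʳ (*-congˡ ξ⁻¹≈sγu₀)))))) ⟩
      ((1# - γ) * (q - γ * (s * s))) * E₁ + ((1# - q) * (1# - t)) * (1# - ((γ * ((s * γ) * u₀)) * s) * v)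
        ≈⟨ solve 7 (λ q γ s u₀ t w v →
             ((1ᴾ :+ :- γ) :* (q :+ :- (γ :* (s :* s)))) :* (1ᴾ :+ :- ((u₀ :* t) :* v))
               :+ ((1ᴾ :+ :- q) :* (1ᴾ :+ :- t)) :* (1ᴾ :+ :- (((γ :* ((s :* γ) :* u₀)) :* s) :* v))
             := (((1ᴾ :+ :- t) :* (1ᴾ :+ :- (((γ :* γ) :* (s :* s)) :* w))) :* (1ᴾ :+ :- ((q :* (u₀ :* t)) :* v))
                 :+ ((((q :* t) :+ :- (γ :* q)) :+ :- (γ :* (s :* s))) :+ ((γ :* γ) :* (s :* s)) :* w) :* (1ᴾ :+ :- ((u₀ :* t) :* v)))
               :+ ((γ :* γ) :* (s :* s)) :* ((1ᴾ :+ :- (t :* w)) :* (1ᴾ :+ :- ((u₀ :* v) :* ((1ᴾ :+ :- q) :+ q :* t)))))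
             refl q γ s u₀ t w v ⟩
      (a * E₂ + b * E₁) + ((γ * γ) * (s * s)) * ((1# - t * w) * (1# - (u₀ * v) * ((1# - q) + q * t)))
        ≈⟨ +-congˡ (trans (*-congˡ (trans (*-congʳ (x≈1⇒1-x≈0 tw≈1)) (zeroˡ _))) (zeroʳ _)) ⟩
      (a * E₂ + b * E₁) + 0#
        ≈⟨ +-identityʳ _ ⟩
      a * E₂ + b * E₁ ∎

  numeratorB-factorisation : ∀ q q′ γ s t w → q * q′ ≈ 1# → t * w ≈ 1# →
    numeratorB q γ s t w ≈ (q * t) * ((1# - γ * w) * (1# - ((s * s) * γ) * (q′ * w)))
  numeratorB-factorisation q q′ γ s t w qq′≈1 tw≈1 = begin
    numeratorB q γ s t w
      ≈⟨ solve 6 (λ q q′ γ s t w →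
           (((q :* t) :+ :- (γ :* q)) :+ :- (γ :* (s :* s))) :+ ((γ :* γ) :* (s :* s)) :* w
           := ((q :* t) :* ((1ᴾ :+ :- (γ :* w)) :* (1ᴾ :+ :- (((s :* s) :* γ) :* (q′ :* w)))) :+ (:- (q :* γ)) :* (1ᴾ :+ :- (t :* w)))
             :+ (((γ :* γ) :* (s :* s)) :* w :+ :- (γ :* (s :* s))) :* (1ᴾ :+ :- ((q :* q′) :* (t :* w))))
         refl q q′ γ s t w ⟩
    ((q * t) * f + (- (q * γ)) * (1# - t * w)) + g * (1# - (q * q′) * (t * w))
      ≈⟨ +-cong (+-congˡ (trans (*-congˡ (x≈1⇒1-x≈0 tw≈1)) (zeroʳ _)))
                (trans (*-congˡ (x≈1⇒1-x≈0 (trans (*-cong qq′≈1 tw≈1) (*-identityˡ 1#)))) (zeroʳ _)) ⟩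
    ((q * t) * f + 0#) + 0#
      ≈⟨ trans (+-identityʳ _) (+-identityʳ _) ⟩
    (q * t) * f ∎
    where
    f = (1# - γ * w) * (1# - ((s * s) * γ) * (q′ * w))
    g = ((γ * γ) * (s * s)) * w - γ * (s * s)

  module Setting (m : ℕ) (q γ s₀ ξ₀ : Carrier) (v : Fin (suc m) → Carrier)
                 (q≉0 : ¬ (q ≈ 0#)) (γ≉0 : ¬ (γ ≈ 0#)) (s₀≉0 : ¬ (s₀ ≈ 0#)) (ξ₀≉0 : ¬ (ξ₀ ≈ 0#)) where
    open FiniteSumsAndProducts F
    open PairProducts F
    open Determinants F
    open CauchyDeterminant F

    N : ℕ
    N = suc m

    u₀ : Carrier
    u₀ = ((s₀ * ξ₀) * γ) ⁻¹

    u x : Fin N → Carrier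
    u i = u₀ * pow q (toℕ i)
    x i = q * u i

    A B R : Fin N → Carrier
    A i = numeratorA γ s₀ (pow q (toℕ i)) (pow (q ⁻¹) (toℕ i))
    B i = numeratorB q γ s₀ (pow q (toℕ i)) (pow (q ⁻¹) (toℕ i))
    R j = (1# - γ * pow (q ⁻¹) (toℕ j)) * (1# - ((s₀ * s₀) * γ) * pow (q ⁻¹) (suc (toℕ j)))

    Z : Matrix N
    Z i j = zfun q γ s₀ ξ₀ (u i) (v j)

    u-suc : ∀ i → u (suc i) ≈ x (inject₁ i)
    u-suc i = begin
      u₀ * (q * pow q (toℕ i))             ≈⟨ solve 3 (λ a b c → a :* (b :* c) := b :* (a :* c)) refl u₀ q (pow q (toℕ i)) ⟩
      q * (u₀ * pow q (toℕ i))             ≡⟨ ≡.cong (λ k → q * (u₀ * pow q k)) (≡.sym (toℕ-inject₁ i)) ⟩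
      q * (u₀ * pow q (toℕ (inject₁ i)))   ∎

    A₀≈0 : A zero ≈ 0#
    A₀≈0 = trans (*-congʳ (-‿inverseʳ 1#)) (zeroˡ _)

    module _ (1-uv≉0 : ∀ i j → ¬ (1# - u i * v j ≈ 0#)) (1-quv≉0 : ∀ i j → ¬ (1# - (q * u i) * v j ≈ 0#)) where

      Z≈partialFractions : ∀ i j → Z i j ≈ A i * (1# - u i * v j) ⁻¹ + B i * (1# - x i * v j) ⁻¹
      Z≈partialFractions i j = zfun-partialFractions q γ s₀ ξ₀ u₀ (pow q (toℕ i)) (pow (q ⁻¹) (toℕ i)) (v j)
        (⁻¹-inverse _ (*-≉0 (*-≉0 s₀≉0 ξ₀≉0) γ≉0)) ξ₀≉0 (pow-*-pow⁻¹ q (toℕ i) q≉0) (1-uv≉0 i j) (1-quv≉0 i j)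

      Z≈bidiagonalCauchy : ∀ i j → Z i j ≈ bidiagonalCauchy (λ i → A (suc i)) B x v i j
      Z≈bidiagonalCauchy zero    j = begin
        Z zero j                                            ≈⟨ Z≈partialFractions zero j ⟩
        A zero * (1# - u zero * v j) ⁻¹ + B zero * (1# - x zero * v j) ⁻¹
          ≈⟨ +-congʳ (trans (*-congʳ A₀≈0) (zeroˡ _)) ⟩
        0# + B zero * (1# - x zero * v j) ⁻¹                ≈⟨ +-identityˡ _ ⟩
        B zero * (1# - x zero * v j) ⁻¹                     ∎
      Z≈bidiagonalCauchy (suc i) j = trans (Z≈partialFractions (suc i) j)
        (+-congʳ (*-congˡ (⁻¹-cong (+-congˡ (-‿cong (*-congʳ (u-suc i)))))))

      cauchyProduct-det-Z : cauchyProduct N x v * det N Z ≈ prodFin N B * (vandermonde N x * vandermonde N v)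
      cauchyProduct-det-Z = trans (*-congˡ (det-cong N Z≈bidiagonalCauchy))
        (det-bidiagonalCauchy m (λ i → A (suc i)) B x v 1-quv≉0)

    prodFin-B : prodFin N B ≈ (pow q N * pow q (triangular N)) * prodFin N R
    prodFin-B = begin
      prodFin N B
        ≈⟨ prodFin-cong N (λ j → numeratorB-factorisation q (q ⁻¹) γ s₀ _ _ (⁻¹-inverse q q≉0) (pow-*-pow⁻¹ q (toℕ j) q≉0)) ⟩
      prodFin N (λ j → (q * pow q (toℕ j)) * R j)
        ≈⟨ prodFin-distrib-* N (λ j → q * pow q (toℕ j)) R ⟩
      prodFin N (λ j → q * pow q (toℕ j)) * prodFin N R
        ≈⟨ *-congʳ (prodFin-scale N q (λ j → pow q (toℕ j))) ⟩
      (pow q N * prodFin N (λ j → pow q (toℕ j))) * prodFin N R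
        ≈⟨ *-congʳ (*-congˡ (prodFin-pow N q)) ⟩
      (pow q N * pow q (triangular N)) * prodFin N R ∎

    prefactor-split : prodFin N (λ i → prodFin N (λ j → (1# - u i * v j) * (1# - (q * u i) * v j)))
                      ≈ prodFin N (λ i → prodFin N (λ j → 1# - u i * v j)) * cauchyProduct N x v
    prefactor-split = trans (prodFin-cong N (λ i → prodFin-distrib-* N (λ j → 1# - u i * v j) (λ j → 1# - x i * v j)))
      (prodFin-distrib-* N (λ i → prodFin N (λ j → 1# - u i * v j)) (λ i → prodFin N (λ j → 1# - x i * v j)))

    prefactor-transpose : prodFin N (λ i → prodFin N (λ j → 1# - u i * v j))
                          ≈ prodFin N (λ i → prodFin N (λ j → 1# - v i * (pow q (toℕ j) * u₀)))
    prefactor-transpose = trans (prodFin-comm N N (λ i j → 1# - u i * v j))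
      (prodFin-cong N (λ j → prodFin-cong N (λ i →
        solve 3 (λ a p w → 1ᴾ :+ :- ((a :* p) :* w) := 1ᴾ :+ :- (w :* (p :* a))) refl u₀ (pow q (toℕ i)) (v j))))

    pow-N*N : pow q (N ℕ.* N) ≈ pow q N * (pow q (triangular N) * pow q (triangular N))
    pow-N*N = begin
      pow q (N ℕ.* N)                                          ≡⟨ ≡.cong (pow q) (≡.sym (triangular-double N)) ⟩
      pow q (N ℕ.+ (triangular N ℕ.+ triangular N))            ≈⟨ pow-+ q N _ ⟩
      pow q N * pow q (triangular N ℕ.+ triangular N)          ≈⟨ *-congˡ (pow-+ q (triangular N) (triangular N)) ⟩
      pow q N * (pow q (triangular N) * pow q (triangular N))  ∎

lemma3p9 : {c ℓ : Level} (F : Field c ℓ) →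
  let open Field F
      open FieldOps F
  in (N : ℕ) → 1 ≤ N →
     (q γ s₀ ξ₀ : Carrier) → (v : Fin N → Carrier) →
     ¬ (q ≈ 0#) → ¬ (γ ≈ 0#) → ¬ (s₀ ≈ 0#) → ¬ (ξ₀ ≈ 0#) →
     let u₀ = ((s₀ * ξ₀) * γ) ⁻¹
         u  = λ (i : Fin N) → u₀ * pow q (toℕ i)
     in (∀ i j → ¬ ((1# - u i * v j) ≈ 0#)) →
        (∀ i j → ¬ ((1# - (q * u i) * v j) ≈ 0#)) →
        (∀ (i j : Fin N) → i < j → ¬ ((u i - u j) ≈ 0#)) →
        (∀ (i j : Fin N) → i < j → ¬ ((v i - v j) ≈ 0#)) →
        (prodFin N (λ i → prodFin N (λ j →
            (1# - u i * v j) * (1# - (q * u i) * v j)))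
         * (prodLt N (λ i j → (u i - u j) * (v i - v j))) ⁻¹)
        * det N (λ i j → zfun q γ s₀ ξ₀ (u i) (v j))
        ≈
        (pow q (N Data.Nat.* N)
         * prodFin N (λ i → prodFin N (λ j →
             1# - v i * (pow q (toℕ j) * u₀))))
         * prodFin N (λ j →
             (1# - γ * pow (q ⁻¹) (toℕ j))
           * (1# - ((s₀ * s₀) * γ) * pow (q ⁻¹) (Data.Nat.suc (toℕ j))))
lemma3p9 F (suc m) _ q γ s₀ ξ₀ v q≉0 γ≉0 s₀≉0 ξ₀≉0 1-uv≉0 1-quv≉0 u-distinct v-distinct = begin
  (P * L ⁻¹) * det N Z
    ≈⟨ *-congʳ (*-congʳ prefactor-split) ⟩
  ((Pᵤ * C) * L ⁻¹) * det N Z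
    ≈⟨ solve 4 (λ a b c d → ((a :* b) :* c) :* d := (a :* c) :* (b :* d)) refl Pᵤ C (L ⁻¹) (det N Z) ⟩
  (Pᵤ * L ⁻¹) * (C * det N Z)
    ≈⟨ *-congˡ (trans (cauchyProduct-det-Z 1-uv≉0 1-quv≉0)
                      (*-cong prodFin-B (*-congʳ (vandermonde-scale N q u)))) ⟩
  (Pᵤ * L ⁻¹) * (((qᴺ * qᵀ) * ΠR) * ((qᵀ * Vu) * Vv))
    ≈⟨ solve 8 (λ p l a t r b vu vv → (p :* l) :* (((a :* t) :* r) :* ((b :* vu) :* vv))
                                   := (((a :* (t :* b)) :* p) :* r) :* (l :* (vu :* vv)))
         refl Pᵤ (L ⁻¹) qᴺ qᵀ ΠR qᵀ Vu Vv ⟩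
  (((qᴺ * (qᵀ * qᵀ)) * Pᵤ) * ΠR) * (L ⁻¹ * (Vu * Vv))
    ≈⟨ *-cong (*-congʳ (*-cong (sym pow-N*N) prefactor-transpose))
              (trans (*-congˡ (sym L≈VuVv)) (⁻¹-inverseˡ L L≉0)) ⟩
  ((pow q (N ℕ.* N) * Pᵥ) * ΠR) * 1#
    ≈⟨ *-identityʳ _ ⟩
  (pow q (N ℕ.* N) * Pᵥ) * ΠR ∎
  where
  open Field F hiding (zero)
  open FieldOps F
  open FieldArithmetic F
  open PairProducts F
  open CauchyDeterminant F
  open ℤ-CoefficientRingSolver commutativeRing
  open ZFunction.Setting F m q γ s₀ ξ₀ v q≉0 γ≉0 s₀≉0 ξ₀≉0
  open import Relation.Binary.Reasoning.Setoid setoid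
  P  = prodFin N (λ i → prodFin N (λ j → (1# - u i * v j) * (1# - (q * u i) * v j)))
  Pᵤ = prodFin N (λ i → prodFin N (λ j → 1# - u i * v j))
  Pᵥ = prodFin N (λ i → prodFin N (λ j → 1# - v i * (pow q (toℕ j) * u₀)))
  C  = cauchyProduct N x v
  L  = prodLt N (λ i j → (u i - u j) * (v i - v j))
  Vu = vandermonde N u
  Vv = vandermonde N v
  qᴺ = pow q N
  qᵀ = pow q (triangular N)
  ΠR = prodFin N R
  L≈VuVv : L ≈ Vu * Vv
  L≈VuVv = prodLt-distrib-* N (λ i j → u i - u j) (λ i j → v i - v j)
  L≉0 : ¬ (L ≈ 0#)
  L≉0 = prodLt-≉0 N (λ i j i<j → *-≉0 (u-distinct i j i<j) (v-distinct i j i<j))
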